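{- For all tests $b,c$, expressions $e,f,g,h$ and weights $r,s,t,u\in\mathbb S$: (DF1) $\odot t;(e\oplus_{r,s}f)\equiv e\oplus_{tr,ts}f$; (DF2) $e+_b(f+_cg)\equiv(e+_bf)+_{b+c}g$; (DF3) $e+_b\mathbf 0\equiv b;e$; (DF4) $b;(e+_bf)\equiv b;e$; (DF5) $(e+_bf)\oplus_{r,s}g\equiv(e\oplus_{r,s}g)+_b(f\oplus_{r,s}g)$; (DF6) $(e+_bf)\oplus_{r,s}(g+_bh)\equiv(e\oplus_{r,s}g)+_b(f\oplus_{r,s}h)$; (DF7) $e+_{\mathbf 1}f\equiv e$; (DF8) $b;(e+_cf)\equiv b;e+_cb;f$; (DF9) $b;(e+_cf)\equiv b;(b;e+_cf)$; (DF10) $\odot r;\odot s\equiv\odot(rs)$; (DF11) $\odot r;(e+_bf)\equiv\odot r;e+_b\odot r;f$; (DF12) $g\oplus_{r,s}\odot0\equiv\odot r;g$; (DF13) $b;(e\oplus_{r,s}f)\equiv b;(b;e\oplus_{r,s}f)$; (DF14) $g\oplus_{s,t}(e\oplus_{r,u}\odot0)\equiv g\oplus_{s,tr}e$.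
   Context: Semiring $(\mathbb S,+,\cdot,0,1)$, $0\ne1$, assumed positive, refinement and Conway (with $^*$ satisfying $(a+b)^*=a^*(ba^*)^*$, $(ab)^*=1+a(ba)^*b$). Finite set $T$ of primitive tests; sets $\mathsf{Act}$, $\mathsf{Out}$. Tests $b,c::=\mathbf 0\mid\mathbf 1\mid t\in T\mid\bar b\mid b+c\mid bc$ (false, true, negation, disjunction, conjunction); $\mathsf{At}$ the atoms of the free Boolean algebra on $T$, $\le_{BA}$ entailment. Expressions $e,f::=p\in\mathsf{Act}\mid b\mid e+_bf\mid e;f\mid e^{(b)}\mid v\in\mathsf{Out}\mid e\oplus_{r,s}f$; $\odot r:=\mathbf 1\oplus_{r,0}\mathbf 0$; sequencing binds tighter than choices, $\odot$ tightest. $E(p)_\alpha=E(v)_\alpha=0$; $E(b)_\alpha=1$ if $\alpha\le_{BA}b$ else $0$; $E(e\oplus_{r,s}f)_\alpha=rE(e)_\alpha+sE(f)_\alpha$; $E(e+_bf)_\alpha=E(e)_\alpha$ if $\alpha\le_{BA}b$ else $E(f)_\alpha$; $E(e;f)_\alpha=E(e)_\alpha E(f)_\alpha$; $E(e^{(b)})_\alpha=E(\bar b)_\alpha$. $\equiv$ is the smallest congruence on expressions (identifying Boolean-equivalent tests) containing G1 $e+_be\equiv e$; G2 $e+_bf\equiv b;e+_bf$; G3 $e+_bf\equiv f+_{\bar b}e$; G4 $(e+_bf)+_cg\equiv e+_{bc}(f+_cg)$; D1 $e\oplus_{r,s}(f+_bg)\equiv(e\oplus_{r,s}f)+_b(e\oplus_{r,s}g)$;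 D2 $e\oplus_{r,s}(f\oplus_{t,u}g)\equiv e\oplus_{r,1}(f\oplus_{st,su}g)$; D3 $b;(e\oplus_{r,s}f)\equiv b;(b;e\oplus_{r,s}b;f)$; S1 $\mathbf 1;e\equiv e\equiv e;\mathbf 1$; S2 $(e;f);g\equiv e;(f;g)$; S3 $\mathbf 0;e\equiv\mathbf 0$; S4 $(e\oplus_{r,s}f);g\equiv e;g\oplus_{r,s}f;g$; S5 $(e+_bf);g\equiv e;g+_bf;g$; S6 $v;e\equiv v$; S7 $b;c\equiv bc$; L1 $e^{(b)}\equiv e;e^{(b)}+_b\mathbf 1$; C1 $\odot1\equiv\mathbf 1$; C2 $\odot0;e\equiv\odot0$; W1 $e\oplus_{r,s}e\equiv\odot(r+s);e$; W2 $e\oplus_{r,s}f\equiv f\oplus_{s,r}e$; W3 $e\oplus_{r,s}(f\oplus_{t,u}g)\equiv(e\oplus_{r,st}f)\oplus_{1,su}g$; W4 $e\oplus_{ru,s}f\equiv(\odot u;e)\oplus_{r,s}f$; closed under L2 (from $e\equiv(f\oplus_{r,s}\mathbf 1)+_cg$ infer $c;e^{(b)}\equiv c;((\odot(s^*r);f;e^{(b)})+_b\mathbf 1)$) and F1 (from $g\equiv e;g+_bf$ and $E(e)_\alpha=0$ for all $\alpha$ infer $g\equiv e^{(b)};f$). -}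

module Defs where

open import Level using (Level; _⊔_; suc)
open import Data.Nat using (ℕ)
open import Data.Fin using (Fin)
open import Data.Bool using (Bool; true; false; not; _∧_; _∨_; if_then_else_)
open import Data.Product using (_×_; ∃; ∃-syntax; _,_)
open import Data.Sum using (_⊎_)
open import Relation.Binary.PropositionalEquality using (_≡_)
open import Relation.Nullary using (¬_)
open import Algebra.Structures using (IsSemiring)

record ConwaySemiring (c : Level) : Set (suc c) where
  infixl 7 _*_
  infixl 6 _+_
  field
    Carrier    : Set c
    _+_        : Carrier → Carrier → Carrier
    _*_        : Carrier → Carrier → Carrier
    0#         : Carrier
    1#         : Carrier
    _⋆         : Carrier → Carrier
    isSemiring : IsSemiring _≡_ _+_ _*_ 0# 1#
    0≢1        : ¬ (0# ≡ 1#)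
    zeroSumFree : ∀ a b → a + b ≡ 0# → a ≡ 0# × b ≡ 0#
    noZeroDiv   : ∀ a b → a * b ≡ 0# → a ≡ 0# ⊎ b ≡ 0#
    refinement : ∀ a b c d → a + b ≡ c + d →
      ∃[ x ] ∃[ y ] ∃[ z ] ∃[ w ]
        (a ≡ x + y × b ≡ z + w × c ≡ x + z × d ≡ y + w)
    sumStar  : ∀ a b → (a + b) ⋆ ≡ a ⋆ * (b * a ⋆) ⋆
    prodStar : ∀ a b → (a * b) ⋆ ≡ 1# + a * (b * a) ⋆ * b

module Syntax {c a o : Level} (S : ConwaySemiring c) (n : ℕ)
              (Act : Set a) (Out : Set o) where

  open ConwaySemiring S

  T : Set
  T = Fin n

  infixl 7 _·ᵗ_
  infixl 6 _+ᵗ_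
  data Test : Set where
    𝟘ᵗ 𝟙ᵗ : Test
    prim  : T → Test
    ¬ᵗ_   : Test → Test
    _+ᵗ_  : Test → Test → Test
    _·ᵗ_  : Test → Test → Test

  -- atoms of the free Boolean algebra on T: valuations of T
  At : Set
  At = T → Bool

  evalᵗ : At → Test → Bool
  evalᵗ α 𝟘ᵗ = false
  evalᵗ α 𝟙ᵗ = true
  evalᵗ α (prim t) = α t
  evalᵗ α (¬ᵗ b) = not (evalᵗ α b)
  evalᵗ α (b +ᵗ b') = evalᵗ α b ∨ evalᵗ α b'
  evalᵗ α (b ·ᵗ b') = evalᵗ α b ∧ evalᵗ α b'

  _≤BA_ : At → Test → Set
  α ≤BA b = evalᵗ α b ≡ true

  _≡BA_ : Test → Test → Set
  b ≡BA b' = ∀ α → evalᵗ α b ≡ evalᵗ α b'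

  infixr 6 _+[_]_
  infixr 6 _⊕[_,_]_
  infixr 7 _⨾_
  data Exp : Set (c ⊔ a ⊔ o) where
    act     : Act → Exp
    test    : Test → Exp
    _+[_]_  : Exp → Test → Exp → Exp
    _⨾_     : Exp → Exp → Exp
    loop    : Exp → Test → Exp
    out     : Out → Exp
    _⊕[_,_]_ : Exp → Carrier → Carrier → Exp → Exp

  ⊙ : Carrier → Exp
  ⊙ r = test 𝟙ᵗ ⊕[ r , 0# ] test 𝟘ᵗ

  E : Exp → At → Carrier
  E (act p) α = 0#
  E (out v) α = 0#
  E (test b) α = if evalᵗ α b then 1# else 0#
  E (e ⊕[ r , s ] f) α = r * E e α + s * E f α
  E (e +[ b ] f) α = if evalᵗ α b then E e α else E f α
  E (e ⨾ f) α = E e α * E f α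
  E (loop e b) α = E (test (¬ᵗ b)) α

  infix 4 _≅_
  data _≅_ : Exp → Exp → Set (c ⊔ a ⊔ o) where
    ≅-refl  : ∀ {e} → e ≅ e
    ≅-sym   : ∀ {e f} → e ≅ f → f ≅ e
    ≅-trans : ∀ {e f g} → e ≅ f → f ≅ g → e ≅ g
    test-cong : ∀ {b b'} → b ≡BA b' → test b ≅ test b'
    +-cong  : ∀ {e e' f f' b b'} → e ≅ e' → b ≡BA b' → f ≅ f' →
              e +[ b ] f ≅ e' +[ b' ] f'
    ⨾-cong  : ∀ {e e' f f'} → e ≅ e' → f ≅ f' → e ⨾ f ≅ e' ⨾ f'
    loop-cong : ∀ {e e' b b'} → e ≅ e' → b ≡BA b' → loop e b ≅ loop e' b'
    ⊕-cong  : ∀ {e e' f f' r s} → e ≅ e' → f ≅ f' →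
              e ⊕[ r , s ] f ≅ e' ⊕[ r , s ] f'
    G1 : ∀ {e b} → e +[ b ] e ≅ e
    G2 : ∀ {e f b} → e +[ b ] f ≅ (test b ⨾ e) +[ b ] f
    G3 : ∀ {e f b} → e +[ b ] f ≅ f +[ ¬ᵗ b ] e
    G4 : ∀ {e f g b c'} → (e +[ b ] f) +[ c' ] g ≅ e +[ b ·ᵗ c' ] (f +[ c' ] g)
    D1 : ∀ {e f g b r s} →
         e ⊕[ r , s ] (f +[ b ] g) ≅ (e ⊕[ r , s ] f) +[ b ] (e ⊕[ r , s ] g)
    D2 : ∀ {e f g r s t u} →
         e ⊕[ r , s ] (f ⊕[ t , u ] g) ≅ e ⊕[ r , 1# ] (f ⊕[ s * t , s * u ] g)
    D3 : ∀ {e f b r s} →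
         test b ⨾ (e ⊕[ r , s ] f) ≅ test b ⨾ ((test b ⨾ e) ⊕[ r , s ] (test b ⨾ f))
    S1l : ∀ {e} → test 𝟙ᵗ ⨾ e ≅ e
    S1r : ∀ {e} → e ≅ e ⨾ test 𝟙ᵗ
    S2 : ∀ {e f g} → (e ⨾ f) ⨾ g ≅ e ⨾ (f ⨾ g)
    S3 : ∀ {e} → test 𝟘ᵗ ⨾ e ≅ test 𝟘ᵗ
    S4 : ∀ {e f g r s} → (e ⊕[ r , s ] f) ⨾ g ≅ (e ⨾ g) ⊕[ r , s ] (f ⨾ g)
    S5 : ∀ {e f g b} → (e +[ b ] f) ⨾ g ≅ (e ⨾ g) +[ b ] (f ⨾ g)
    S6 : ∀ {v e} → out v ⨾ e ≅ out v
    S7 : ∀ {b b'} → test b ⨾ test b' ≅ test (b ·ᵗ b')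
    L1 : ∀ {e b} → loop e b ≅ (e ⨾ loop e b) +[ b ] test 𝟙ᵗ
    C1 : ⊙ 1# ≅ test 𝟙ᵗ
    C2 : ∀ {e} → ⊙ 0# ⨾ e ≅ ⊙ 0#
    W1 : ∀ {e r s} → e ⊕[ r , s ] e ≅ ⊙ (r + s) ⨾ e
    W2 : ∀ {e f r s} → e ⊕[ r , s ] f ≅ f ⊕[ s , r ] e
    W3 : ∀ {e f g r s t u} →
         e ⊕[ r , s ] (f ⊕[ t , u ] g) ≅ (e ⊕[ r , s * t ] f) ⊕[ 1# , s * u ] g
    W4 : ∀ {e f r s u} → e ⊕[ r * u , s ] f ≅ (⊙ u ⨾ e) ⊕[ r , s ] f
    L2 : ∀ {e f g b c' r s} →
         e ≅ (f ⊕[ r , s ] test 𝟙ᵗ) +[ c' ] g →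
         test c' ⨾ loop e b ≅ test c' ⨾ ((⊙ (s ⋆ * r) ⨾ f ⨾ loop e b) +[ b ] test 𝟙ᵗ)
    F1 : ∀ {e f g b} →
         g ≅ (e ⨾ g) +[ b ] f → (∀ α → E e α ≡ 0#) → g ≅ loop e b ⨾ f

{-# OPTIONS --safe #-}
-- For guarded choice the key derived law is the exchange
-- e +_b (f +_c g) ≡ f +_{c¬b} (e +_b g), a combination of G3 and G4: it shows that
-- an inner guard only matters where the outer one fails, which yields associativity
-- and absorption, and together with b;e ≡ e +_b 0 it turns a test in front of a
-- guarded choice into an outer guard. For weighted choice, S4 gives
-- ⊙r;e ≡ e ⊕_{r,0} 0, so scaling is a weighted choice against abort and the
-- ⊙-laws reduce to D2, W3, W4 and the semiring law s·0 = 0.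
module Submission where

open import Defs
open import Level using (Level; _⊔_)
open import Data.Nat using (ℕ)
open import Data.Bool using (true; false)
open import Data.Bool.Properties using (not-involutive; ∧-idem; ∧-inverseˡ; ∧-inverseʳ; ∧-comm; ∧-abs-∨; ∧-zeroʳ)
open import Data.Product using (_×_; _,_)
open import Relation.Binary.Bundles using (Setoid)
open import Relation.Binary.PropositionalEquality using (_≡_; refl; sym; cong₂)
open import Algebra.Structures using (IsSemiring)

module GuardedWeightedAlgebra {c a o : Level} (S : ConwaySemiring c) (n : ℕ)
                              (Act : Set a) (Out : Set o) where

  open ConwaySemiring S
  open IsSemiring isSemiring using (zeroʳ)
  open Syntax S n Act Out

  ≅-setoid : Setoid (c ⊔ a ⊔ o) (c ⊔ a ⊔ o)
  ≅-setoid = record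
    { Carrier       = Exp
    ; _≈_           = _≅_
    ; isEquivalence = record { refl = ≅-refl ; sym = ≅-sym ; trans = ≅-trans }
    }

  open Setoid ≅-setoid using (reflexive)
  open import Relation.Binary.Reasoning.Setoid ≅-setoid

  ¬ᵗ-involutive : ∀ b → (¬ᵗ ¬ᵗ b) ≡BA b
  ¬ᵗ-involutive b α = not-involutive (evalᵗ α b)

  ·ᵗ-idem : ∀ b → (b ·ᵗ b) ≡BA b
  ·ᵗ-idem b α = ∧-idem (evalᵗ α b)

  ·ᵗ-comm : ∀ b c → (b ·ᵗ c) ≡BA (c ·ᵗ b)
  ·ᵗ-comm b c α = ∧-comm (evalᵗ α b) (evalᵗ α c)

  ·ᵗ-abs-+ᵗ : ∀ b c → (b ·ᵗ (b +ᵗ c)) ≡BA b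
  ·ᵗ-abs-+ᵗ b c α = ∧-abs-∨ (evalᵗ α b) (evalᵗ α c)

  ·ᵗ-inverseˡ : ∀ b → (¬ᵗ b ·ᵗ b) ≡BA 𝟘ᵗ
  ·ᵗ-inverseˡ b α = ∧-inverseˡ (evalᵗ α b)

  ·ᵗ-inverseʳ-outside : ∀ b → (b ·ᵗ ¬ᵗ b) ≡BA (𝟘ᵗ ·ᵗ ¬ᵗ b)
  ·ᵗ-inverseʳ-outside b α = ∧-inverseʳ (evalᵗ α b)

  +ᵗ-outside : ∀ b c → ((b +ᵗ c) ·ᵗ ¬ᵗ b) ≡BA (c ·ᵗ ¬ᵗ b)
  +ᵗ-outside b c α with evalᵗ α b
  ... | true  = sym (∧-zeroʳ (evalᵗ α c))
  ... | false = refl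

  ·ᵗ-outside-meet : ∀ b c → ((b ·ᵗ ¬ᵗ c) ·ᵗ ¬ᵗ (b ·ᵗ c)) ≡BA (b ·ᵗ ¬ᵗ (b ·ᵗ c))
  ·ᵗ-outside-meet b c α with evalᵗ α b | evalᵗ α c
  ... | true  | true  = refl
  ... | true  | false = refl
  ... | false | _     = refl

  ≡BA-refl : ∀ {b} → b ≡BA b
  ≡BA-refl _ = refl

  +-congˡ : ∀ {e e' f b} → e ≅ e' → e +[ b ] f ≅ e' +[ b ] f
  +-congˡ {b = b} e≅e' = +-cong e≅e' (≡BA-refl {b}) ≅-refl

  +-congʳ : ∀ {e f f' b} → f ≅ f' → e +[ b ] f ≅ e +[ b ] f'
  +-congʳ {b = b} f≅f' = +-cong ≅-refl (≡BA-refl {b}) f≅f'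

  +-guard-cong : ∀ {e f b b'} → b ≡BA b' → e +[ b ] f ≅ e +[ b' ] f
  +-guard-cong b≡b' = +-cong ≅-refl b≡b' ≅-refl

  ⨾-congʳ : ∀ {e f f'} → f ≅ f' → e ⨾ f ≅ e ⨾ f'
  ⨾-congʳ = ⨾-cong ≅-refl

  ⊕-congˡ : ∀ {e e' f r s} → e ≅ e' → e ⊕[ r , s ] f ≅ e' ⊕[ r , s ] f
  ⊕-congˡ e≅e' = ⊕-cong e≅e' ≅-refl

  ⊕-congʳ : ∀ {e f f' r s} → f ≅ f' → e ⊕[ r , s ] f ≅ e ⊕[ r , s ] f'
  ⊕-congʳ = ⊕-cong ≅-refl

  ⊕-weights-cong : ∀ {e f r r' s s'} → r ≡ r' → s ≡ s' → e ⊕[ r , s ] f ≅ e ⊕[ r' , s' ] f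
  ⊕-weights-cong {e} {f} r≡r' s≡s' = reflexive (cong₂ (λ r s → e ⊕[ r , s ] f) r≡r' s≡s')

  test-⨾-test : ∀ {b c e} → test b ⨾ (test c ⨾ e) ≅ test (b ·ᵗ c) ⨾ e
  test-⨾-test = ≅-trans (≅-sym S2) (⨾-cong S7 ≅-refl)

  test-⨾-idem : ∀ {b e} → test b ⨾ (test b ⨾ e) ≅ test b ⨾ e
  test-⨾-idem {b} = ≅-trans test-⨾-test (⨾-cong (test-cong (·ᵗ-idem b)) ≅-refl)

  +-falseᵗ : ∀ {e f} → e +[ 𝟘ᵗ ] f ≅ f
  +-falseᵗ {e} {f} = begin
    e +[ 𝟘ᵗ ] f               ≈⟨ G2 ⟩
    (test 𝟘ᵗ ⨾ e) +[ 𝟘ᵗ ] f   ≈⟨ +-congˡ S3 ⟩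
    test 𝟘ᵗ +[ 𝟘ᵗ ] f         ≈⟨ +-congˡ S3 ⟨
    (test 𝟘ᵗ ⨾ f) +[ 𝟘ᵗ ] f   ≈⟨ G2 ⟨
    f +[ 𝟘ᵗ ] f               ≈⟨ G1 ⟩
    f                         ∎

  +-trueᵗ : ∀ {e f} → e +[ 𝟙ᵗ ] f ≅ e
  +-trueᵗ {e} {f} = begin
    e +[ 𝟙ᵗ ] f      ≈⟨ G3 ⟩
    f +[ ¬ᵗ 𝟙ᵗ ] e   ≈⟨ +-guard-cong (≡BA-refl {𝟘ᵗ}) ⟩
    f +[ 𝟘ᵗ ] e      ≈⟨ +-falseᵗ ⟩
    e                ∎

  G2ʳ : ∀ {e f b} → e +[ b ] f ≅ e +[ b ] (test (¬ᵗ b) ⨾ f)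
  G2ʳ {e} {f} {b} = begin
    e +[ b ] f                          ≈⟨ G3 ⟩
    f +[ ¬ᵗ b ] e                       ≈⟨ G2 ⟩
    (test (¬ᵗ b) ⨾ f) +[ ¬ᵗ b ] e       ≈⟨ G3 ⟩
    e +[ ¬ᵗ ¬ᵗ b ] (test (¬ᵗ b) ⨾ f)    ≈⟨ +-guard-cong (¬ᵗ-involutive b) ⟩
    e +[ b ] (test (¬ᵗ b) ⨾ f)          ∎

  +-exchange : ∀ {e f g b c} → e +[ b ] (f +[ c ] g) ≅ f +[ c ·ᵗ ¬ᵗ b ] (e +[ b ] g)
  +-exchange {e} {f} {g} {b} {c} = begin
    e +[ b ] (f +[ c ] g)               ≈⟨ G3 ⟩
    (f +[ c ] g) +[ ¬ᵗ b ] e            ≈⟨ G4 ⟩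
    f +[ c ·ᵗ ¬ᵗ b ] (g +[ ¬ᵗ b ] e)    ≈⟨ +-congʳ G3 ⟩
    f +[ c ·ᵗ ¬ᵗ b ] (e +[ ¬ᵗ ¬ᵗ b ] g) ≈⟨ +-congʳ (+-guard-cong (¬ᵗ-involutive b)) ⟩
    f +[ c ·ᵗ ¬ᵗ b ] (e +[ b ] g)       ∎

  +-inner-guard-cong : ∀ {e f g b c c'} → (c ·ᵗ ¬ᵗ b) ≡BA (c' ·ᵗ ¬ᵗ b) →
                       e +[ b ] (f +[ c ] g) ≅ e +[ b ] (f +[ c' ] g)
  +-inner-guard-cong c≡c' =
    ≅-trans +-exchange (≅-trans (+-guard-cong c≡c') (≅-sym +-exchange))

  +-absorbʳ : ∀ {e f g b} → e +[ b ] (f +[ b ] g) ≅ e +[ b ] g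
  +-absorbʳ {b = b} = ≅-trans (+-inner-guard-cong (·ᵗ-inverseʳ-outside b)) (+-congʳ +-falseᵗ)

  +-absorbˡ : ∀ {e f g b} → (e +[ b ] f) +[ b ] g ≅ e +[ b ] g
  +-absorbˡ {b = b} = ≅-trans G4 (≅-trans (+-guard-cong (·ᵗ-idem b)) +-absorbʳ)

  +-assoc : ∀ {e f g b c} → e +[ b ] (f +[ c ] g) ≅ (e +[ b ] f) +[ b +ᵗ c ] g
  +-assoc {e} {f} {g} {b} {c} = begin
    e +[ b ] (f +[ c ] g)                   ≈⟨ +-inner-guard-cong (+ᵗ-outside b c) ⟨
    e +[ b ] (f +[ b +ᵗ c ] g)              ≈⟨ +-guard-cong (·ᵗ-abs-+ᵗ b c) ⟨
    e +[ b ·ᵗ (b +ᵗ c) ] (f +[ b +ᵗ c ] g)  ≈⟨ G4 ⟨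
    (e +[ b ] f) +[ b +ᵗ c ] g              ∎

  +-abort : ∀ {e b} → e +[ b ] test 𝟘ᵗ ≅ test b ⨾ e
  +-abort {e} {b} = begin
    e +[ b ] test 𝟘ᵗ                                  ≈⟨ G2 ⟩
    (test b ⨾ e) +[ b ] test 𝟘ᵗ                       ≈⟨ +-congʳ S3 ⟨
    (test b ⨾ e) +[ b ] (test 𝟘ᵗ ⨾ e)                 ≈⟨ +-congʳ (⨾-cong (test-cong (·ᵗ-inverseˡ b)) ≅-refl) ⟨
    (test b ⨾ e) +[ b ] (test (¬ᵗ b ·ᵗ b) ⨾ e)        ≈⟨ +-congʳ test-⨾-test ⟨
    (test b ⨾ e) +[ b ] (test (¬ᵗ b) ⨾ test b ⨾ e)    ≈⟨ G2ʳ ⟨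
    (test b ⨾ e) +[ b ] (test b ⨾ e)                  ≈⟨ G1 ⟩
    test b ⨾ e                                        ∎

  test-⨾-+-taken : ∀ {e f b} → test b ⨾ (e +[ b ] f) ≅ test b ⨾ e
  test-⨾-+-taken = ≅-trans (≅-sym +-abort) (≅-trans +-absorbˡ +-abort)

  test-⨾-distrib-+ : ∀ {e f b c} → test b ⨾ (e +[ c ] f) ≅ (test b ⨾ e) +[ c ] (test b ⨾ f)
  test-⨾-distrib-+ {e} {f} {b} {c} = begin
    test b ⨾ (e +[ c ] f)                                        ≈⟨ +-abort ⟨
    (e +[ c ] f) +[ b ] test 𝟘ᵗ                                  ≈⟨ G4 ⟩
    e +[ c ·ᵗ b ] (f +[ b ] test 𝟘ᵗ)                             ≈⟨ +-guard-cong (·ᵗ-comm c b) ⟩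
    e +[ b ·ᵗ c ] (f +[ b ] test 𝟘ᵗ)                             ≈⟨ +-inner-guard-cong (·ᵗ-outside-meet b c) ⟨
    e +[ b ·ᵗ c ] (f +[ b ·ᵗ ¬ᵗ c ] test 𝟘ᵗ)                     ≈⟨ +-congʳ (+-congʳ G1) ⟨
    e +[ b ·ᵗ c ] (f +[ b ·ᵗ ¬ᵗ c ] (test 𝟘ᵗ +[ c ] test 𝟘ᵗ))   ≈⟨ +-congʳ +-exchange ⟨
    e +[ b ·ᵗ c ] (test 𝟘ᵗ +[ c ] (f +[ b ] test 𝟘ᵗ))           ≈⟨ G4 ⟨
    (e +[ b ] test 𝟘ᵗ) +[ c ] (f +[ b ] test 𝟘ᵗ)                ≈⟨ +-cong +-abort (≡BA-refl {c}) +-abort ⟩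
    (test b ⨾ e) +[ c ] (test b ⨾ f)                             ∎

  test-⨾-+-propagateˡ : ∀ {e f b c} → test b ⨾ (e +[ c ] f) ≅ test b ⨾ ((test b ⨾ e) +[ c ] f)
  test-⨾-+-propagateˡ =
    ≅-trans test-⨾-distrib-+ (≅-trans (+-congˡ (≅-sym test-⨾-idem)) (≅-sym test-⨾-distrib-+))

  ⊙-⨾ : ∀ {e r} → ⊙ r ⨾ e ≅ e ⊕[ r , 0# ] test 𝟘ᵗ
  ⊙-⨾ = ≅-trans S4 (⊕-cong S1l S3)

  ⊕-identity : ∀ {e} → e ⊕[ 1# , 0# ] test 𝟘ᵗ ≅ e
  ⊕-identity {e} = begin
    e ⊕[ 1# , 0# ] test 𝟘ᵗ   ≈⟨ ⊙-⨾ ⟨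
    ⊙ 1# ⨾ e                 ≈⟨ ⨾-cong C1 ≅-refl ⟩
    test 𝟙ᵗ ⨾ e              ≈⟨ S1l ⟩
    e                        ∎

  ⊙-⨾-⊕ : ∀ {e f r s t} → ⊙ t ⨾ (e ⊕[ r , s ] f) ≅ e ⊕[ t * r , t * s ] f
  ⊙-⨾-⊕ {e} {f} {r} {s} {t} = begin
    ⊙ t ⨾ (e ⊕[ r , s ] f)                          ≈⟨ ⊙-⨾ ⟩
    (e ⊕[ r , s ] f) ⊕[ t , 0# ] test 𝟘ᵗ            ≈⟨ W2 ⟩
    test 𝟘ᵗ ⊕[ 0# , t ] (e ⊕[ r , s ] f)            ≈⟨ D2 ⟩
    test 𝟘ᵗ ⊕[ 0# , 1# ] (e ⊕[ t * r , t * s ] f)  ≈⟨ W2 ⟩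
    (e ⊕[ t * r , t * s ] f) ⊕[ 1# , 0# ] test 𝟘ᵗ  ≈⟨ ⊕-identity ⟩
    e ⊕[ t * r , t * s ] f                          ∎

  ⊙-⨾-⊙ : ∀ {r s} → ⊙ r ⨾ ⊙ s ≅ ⊙ (r * s)
  ⊙-⨾-⊙ {r} {s} = begin
    ⊙ r ⨾ ⊙ s                             ≈⟨ ⊙-⨾ ⟩
    ⊙ s ⊕[ r , 0# ] test 𝟘ᵗ               ≈⟨ ⊕-congˡ S1r ⟩
    (⊙ s ⨾ test 𝟙ᵗ) ⊕[ r , 0# ] test 𝟘ᵗ   ≈⟨ W4 ⟨
    ⊙ (r * s)                             ∎

  ⊕-distribʳ-+ : ∀ {e f g b r s} →
                 (e +[ b ] f) ⊕[ r , s ] g ≅ (e ⊕[ r , s ] g) +[ b ] (f ⊕[ r , s ] g)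
  ⊕-distribʳ-+ {b = b} = ≅-trans W2 (≅-trans D1 (+-cong W2 (≡BA-refl {b}) W2))

  ⊕-distrib-+ : ∀ {e f g h b r s} →
                (e +[ b ] f) ⊕[ r , s ] (g +[ b ] h) ≅ (e ⊕[ r , s ] g) +[ b ] (f ⊕[ r , s ] h)
  ⊕-distrib-+ {b = b} =
    ≅-trans ⊕-distribʳ-+ (≅-trans (+-cong D1 (≡BA-refl {b}) D1) (≅-trans +-absorbˡ +-absorbʳ))

  ⊙-⨾-distrib-+ : ∀ {e f b r} → ⊙ r ⨾ (e +[ b ] f) ≅ (⊙ r ⨾ e) +[ b ] (⊙ r ⨾ f)
  ⊙-⨾-distrib-+ {b = b} =
    ≅-trans ⊙-⨾ (≅-trans ⊕-distribʳ-+ (+-cong (≅-sym ⊙-⨾) (≡BA-refl {b}) (≅-sym ⊙-⨾)))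

  ⊙-zero : ⊙ 0# ≅ test 𝟘ᵗ ⊕[ 0# , 0# ] test 𝟘ᵗ
  ⊙-zero = ≅-trans (≅-sym (C2 {test 𝟘ᵗ})) ⊙-⨾

  ⊕-flattenʳ : ∀ {e f r s t} → e ⊕[ r , s ] (f ⊕[ t , 0# ] test 𝟘ᵗ) ≅ e ⊕[ r , s * t ] f
  ⊕-flattenʳ {e} {f} {r} {s} {t} = begin
    e ⊕[ r , s ] (f ⊕[ t , 0# ] test 𝟘ᵗ)              ≈⟨ W3 ⟩
    (e ⊕[ r , s * t ] f) ⊕[ 1# , s * 0# ] test 𝟘ᵗ    ≈⟨ ⊕-weights-cong refl (zeroʳ s) ⟩
    (e ⊕[ r , s * t ] f) ⊕[ 1# , 0# ] test 𝟘ᵗ        ≈⟨ ⊕-identity ⟩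
    e ⊕[ r , s * t ] f                               ∎

  ⊕-⊙-zero : ∀ {g r s} → g ⊕[ r , s ] ⊙ 0# ≅ ⊙ r ⨾ g
  ⊕-⊙-zero {g} {r} {s} = begin
    g ⊕[ r , s ] ⊙ 0#                             ≈⟨ ⊕-congʳ ⊙-zero ⟩
    g ⊕[ r , s ] (test 𝟘ᵗ ⊕[ 0# , 0# ] test 𝟘ᵗ)   ≈⟨ ⊕-flattenʳ ⟩
    g ⊕[ r , s * 0# ] test 𝟘ᵗ                     ≈⟨ ⊕-weights-cong refl (zeroʳ s) ⟩
    g ⊕[ r , 0# ] test 𝟘ᵗ                         ≈⟨ ⊙-⨾ ⟨
    ⊙ r ⨾ g                                       ∎

  ⊕-nested-⊙-zero : ∀ {e g r s t u} → g ⊕[ s , t ] (e ⊕[ r , u ] ⊙ 0#) ≅ g ⊕[ s , t * r ] e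
  ⊕-nested-⊙-zero = ≅-trans (⊕-congʳ (≅-trans ⊕-⊙-zero ⊙-⨾)) ⊕-flattenʳ

  test-⨾-⊕-propagateˡ : ∀ {e f b r s} →
                        test b ⨾ (e ⊕[ r , s ] f) ≅ test b ⨾ ((test b ⨾ e) ⊕[ r , s ] f)
  test-⨾-⊕-propagateˡ {e} {f} {b} {r} {s} = begin
    test b ⨾ (e ⊕[ r , s ] f)                                  ≈⟨ D3 ⟩
    test b ⨾ ((test b ⨾ e) ⊕[ r , s ] (test b ⨾ f))            ≈⟨ ⨾-congʳ (⊕-congˡ test-⨾-idem) ⟨
    test b ⨾ ((test b ⨾ test b ⨾ e) ⊕[ r , s ] (test b ⨾ f))   ≈⟨ D3 ⟨
    test b ⨾ ((test b ⨾ e) ⊕[ r , s ] f)                       ∎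

mainTheorem10 : {c a o : Level} (S : ConwaySemiring c) (n : ℕ) (Act : Set a) (Out : Set o) →
    let open ConwaySemiring S
        open Syntax S n Act Out
    in ∀ (b c' : Test) (e f g h : Exp) (r s t u : Carrier) →
      (⊙ t ⨾ (e ⊕[ r , s ] f) ≅ e ⊕[ t * r , t * s ] f)
      × (e +[ b ] (f +[ c' ] g) ≅ (e +[ b ] f) +[ b +ᵗ c' ] g)
      × (e +[ b ] test 𝟘ᵗ ≅ test b ⨾ e)
      × (test b ⨾ (e +[ b ] f) ≅ test b ⨾ e)
      × ((e +[ b ] f) ⊕[ r , s ] g ≅ (e ⊕[ r , s ] g) +[ b ] (f ⊕[ r , s ] g))
      × ((e +[ b ] f) ⊕[ r , s ] (g +[ b ] h) ≅ (e ⊕[ r , s ] g) +[ b ] (f ⊕[ r , s ] h))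
      × (e +[ 𝟙ᵗ ] f ≅ e)
      × (test b ⨾ (e +[ c' ] f) ≅ (test b ⨾ e) +[ c' ] (test b ⨾ f))
      × (test b ⨾ (e +[ c' ] f) ≅ test b ⨾ ((test b ⨾ e) +[ c' ] f))
      × (⊙ r ⨾ ⊙ s ≅ ⊙ (r * s))
      × (⊙ r ⨾ (e +[ b ] f) ≅ (⊙ r ⨾ e) +[ b ] (⊙ r ⨾ f))
      × (g ⊕[ r , s ] ⊙ 0# ≅ ⊙ r ⨾ g)
      × (test b ⨾ (e ⊕[ r , s ] f) ≅ test b ⨾ ((test b ⨾ e) ⊕[ r , s ] f))
      × (g ⊕[ s , t ] (e ⊕[ r , u ] ⊙ 0#) ≅ g ⊕[ s , t * r ] e)
mainTheorem10 S n Act Out b c' e f g h r s t u =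
    ⊙-⨾-⊕ , +-assoc , +-abort , test-⨾-+-taken , ⊕-distribʳ-+ , ⊕-distrib-+ , +-trueᵗ
  , test-⨾-distrib-+ , test-⨾-+-propagateˡ , ⊙-⨾-⊙ , ⊙-⨾-distrib-+ , ⊕-⊙-zero
  , test-⨾-⊕-propagateˡ , ⊕-nested-⊙-zero
  where open GuardedWeightedAlgebra S n Act Out
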